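{- Let $G$ be a split graph with a partition of $V(G)$ into a clique $C(G)$ and an independent set $I(G)$, and let $G'$ be an interval graph on the vertex set $V(G)$ with $E(G)\subseteq E(G')$. Then there is a split interval graph $H$ on $V(G)$ with $E(G)\subseteq E(H)\subseteq E(G')$ such that $I(G)$ is an independent set of $H$ (so $H$ is split with clique $C(G)$ and independent set $I(H)=I(G)$).
   Context: All graphs are finite, simple and undirected. A split graph is a graph whose vertex set can be partitioned into a clique and an independent set. An interval graph is the intersection graph of a family of closed intervals on the real line. A split interval graph is a graph that is both a split graph and an interval graph.
   Formalization: The closed intervals defining interval graphs, for G′ as well as for H, have rational endpoints rather than real ones. -}

module Defs where

open import Data.Nat using (ℕ)
open import Data.Fin using (Fin)
open import Data.Bool using (Bool; true; false)
open import Data.Rational using (ℚ; _≤_)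
open import Data.Product using (_×_; Σ; ∃; ∃-syntax)
open import Relation.Binary.PropositionalEquality using (_≡_)
open import Relation.Nullary using (¬_)
open import Function.Bundles using (_⇔_)

record Graph (n : ℕ) : Set where
  field
    adj    : Fin n → Fin n → Bool
    sym    : ∀ u v → adj u v ≡ adj v u
    irrefl : ∀ v → adj v v ≡ false
open Graph public

Edge : ∀ {n} → Graph n → Fin n → Fin n → Set
Edge G u v = adj G u v ≡ true

_⊆E_ : ∀ {n} → Graph n → Graph n → Set
G ⊆E H = ∀ u v → Edge G u v → Edge H u v

VSet : ℕ → Set
VSet n = Fin n → Bool

_∈ᵥ_ : ∀ {n} → Fin n → VSet n → Set
v ∈ᵥ S = S v ≡ true

_∉ᵥ_ : ∀ {n} → Fin n → VSet n → Set
v ∉ᵥ S = S v ≡ false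

IsClique : ∀ {n} → Graph n → VSet n → Set
IsClique G S = ∀ u v → u ∈ᵥ S → v ∈ᵥ S → ¬ (u ≡ v) → Edge G u v

IsIndependent : ∀ {n} → Graph n → VSet n → Set
IsIndependent G S = ∀ u v → u ∈ᵥ S → v ∈ᵥ S → ¬ Edge G u v

Complement : ∀ {n} → VSet n → VSet n
Complement C v = Data.Bool.not (C v)

IsSplitPartition : ∀ {n} → Graph n → VSet n → Set
IsSplitPartition G C = IsClique G C × IsIndependent G (Complement C)

IsSplit : ∀ {n} → Graph n → Set
IsSplit G = ∃[ C ] IsSplitPartition G C

record Interval : Set where
  field
    lo  : ℚ
    hi  : ℚ
    ok  : lo ≤ hi
open Interval public

Meets : Interval → Interval → Set
Meets I J = (lo I ≤ hi J) × (lo J ≤ hi I)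

IsIntervalModel : ∀ {n} → Graph n → (Fin n → Interval) → Set
IsIntervalModel G f = ∀ u v → ¬ (u ≡ v) → (Edge G u v ⇔ Meets (f u) (f v))

IsInterval : ∀ {n} → Graph n → Set
IsInterval G = ∃[ f ] IsIntervalModel G f

IsSplitInterval : ∀ {n} → Graph n → Set
IsSplitInterval G = IsSplit G × IsInterval G

{-# OPTIONS --safe #-}

-- Take an interval model f of G′. Clique vertices keep their intervals. For an independent
-- vertex v, the intervals of v and of its neighbours pairwise intersect (these vertices form a
-- clique of G ⊆ G′), so by the Helly property they share a point, namely their largest left
-- endpoint; v is shrunk to that point. To keep the independent vertices pairwise disjoint,
-- every coordinate is replaced by its rank among the left endpoints of f, scaled by n + 1, and
-- the point of v is shifted by the index of v; H is the intersection graph of the new family.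
module Submission where

open import Defs
open import Data.Nat using (ℕ)
open import Data.Product using (_×_; ∃-syntax)

open import Data.Bool using (Bool; true; false; not)
import Data.Bool.Properties as Bool
open import Data.Fin using (Fin; toℕ; _≟_)
open import Data.Fin.Properties using (toℕ-injective; toℕ≤n)
open import Data.Integer using (+_; +≤+) renaming (_≤_ to _≤ℤ_)
import Data.Integer.Properties as ℤ
open import Data.List using (List; []; _∷_; filter; tabulate; allFin)
open import Data.List.Membership.Propositional using (_∈_)
open import Data.List.Membership.Propositional.Properties using (∈-filter⁺; ∈-tabulate⁺; ∈-allFin)
import Data.List.Extrema as Extrema
open import Data.List.Relation.Unary.All as All using (lookup)
open import Data.List.Relation.Unary.All.Properties using (all-filter)
open import Data.List.Relation.Unary.Any using (here; there)
open import Data.Nat as ℕ using (suc; _+_; _*_; z≤n; s≤s)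
open import Data.Nat.DivMod using (_%_; [m+kn]%n≡m%n; m≤n⇒m%n≡m)
import Data.Nat.Properties as ℕ
open import Data.Product using (_,_; proj₁; proj₂)
open import Data.Rational using (ℚ; *≤*)
import Data.Rational as ℚ
import Data.Rational.Properties as ℚ
open import Data.Rational.Literals using (fromℤ)
open import Data.Sum using (_⊎_; inj₁; inj₂)
open import Function using (_∘_)
open import Function.Bundles using (mk⇔; Equivalence)
open import Relation.Binary.Bundles using (DecTotalOrder)
open import Relation.Binary.PropositionalEquality as ≡ using (_≡_; _≢_; refl; trans; cong; subst₂)
open import Relation.Nullary using (Dec; yes; no; does; ¬?; contradiction)
open import Relation.Nullary.Decidable using (_×-dec_; dec-true; dec-false; does-⇔)

edge⇒≢ : ∀ {n} (G : Graph n) {u v} → Edge G u v → u ≢ v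
edge⇒≢ G {u} e refl = contradiction (trans (≡.sym e) (irrefl G u)) λ ()

edge-sym : ∀ {n} (G : Graph n) {u v} → Edge G u v → Edge G v u
edge-sym G {u} {v} e = trans (Graph.sym G v u) e

meets-sym : ∀ {I J} → Meets I J → Meets J I
meets-sym (p , q) = q , p

meets? : ∀ I J → Dec (Meets I J)
meets? I J = (lo I ℚ.≤? hi J) ×-dec (lo J ℚ.≤? hi I)

Intersecting : ∀ {n} → (Fin n → Interval) → Fin n → Fin n → Set
Intersecting f u v = u ≢ v × Meets (f u) (f v)

intersecting? : ∀ {n} (f : Fin n → Interval) u v → Dec (Intersecting f u v)
intersecting? f u v = ¬? (u ≟ v) ×-dec meets? (f u) (f v)

intersecting-sym : ∀ {n} {f : Fin n → Interval} {u v} → Intersecting f u v → Intersecting f v u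
intersecting-sym {f = f} {u} {v} (u≢v , m) = u≢v ∘ ≡.sym , meets-sym {f u} {f v} m

intersectionGraph : ∀ {n} → (Fin n → Interval) → Graph n
intersectionGraph f = record
  { adj    = λ u v → does (intersecting? f u v)
  ; sym    = λ u v → does-⇔ (mk⇔ (intersecting-sym {f = f}) (intersecting-sym {f = f}))
                             (intersecting? f u v) (intersecting? f v u)
  ; irrefl = λ v → dec-false (intersecting? f v v) λ (v≢v , _) → v≢v refl
  }

intersectionGraph-model : ∀ {n} (f : Fin n → Interval) → IsIntervalModel (intersectionGraph f) f
intersectionGraph-model f u v u≢v =
  mk⇔ (proj₂ ∘ witness (intersecting? f u v)) (λ m → dec-true (intersecting? f u v) (u≢v , m))
  where
  witness : ∀ {A : Set} (a? : Dec A) → does a? ≡ true → A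
  witness (yes a) _ = a

fromℕ : ℕ → ℚ
fromℕ k = fromℤ (+ k)

fromℕ-mono-≤ : ∀ {a b} → a ℕ.≤ b → fromℕ a ℚ.≤ fromℕ b
fromℕ-mono-≤ {a} {b} a≤b =
  *≤* (subst₂ _≤ℤ_ (≡.sym (ℤ.*-identityʳ (+ a))) (≡.sym (ℤ.*-identityʳ (+ b))) (+≤+ a≤b))

fromℕ-cancel-≤ : ∀ {a b} → fromℕ a ℚ.≤ fromℕ b → a ℕ.≤ b
fromℕ-cancel-≤ {a} {b} (*≤* p) =
  ℤ.drop‿+≤+ (subst₂ _≤ℤ_ (ℤ.*-identityʳ (+ a)) (ℤ.*-identityʳ (+ b)) p)

ℕ-interval : (a b : ℕ) → a ℕ.≤ b → Interval
ℕ-interval a b a≤b = record { lo = fromℕ a ; hi = fromℕ b ; ok = fromℕ-mono-≤ a≤b }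

rank : List ℚ → ℚ → ℕ
rank []       q = 0
rank (e ∷ es) q with e ℚ.≤? q
... | yes _ = suc (rank es q)
... | no  _ = rank es q

rank-mono-≤ : ∀ es {q r} → q ℚ.≤ r → rank es q ℕ.≤ rank es r
rank-mono-≤ []       q≤r = z≤n
rank-mono-≤ (e ∷ es) {q} {r} q≤r with e ℚ.≤? q | e ℚ.≤? r
... | yes _   | yes _   = s≤s (rank-mono-≤ es q≤r)
... | yes e≤q | no  e≰r = contradiction (ℚ.≤-trans e≤q q≤r) e≰r
... | no  _   | yes _   = ℕ.m≤n⇒m≤1+n (rank-mono-≤ es q≤r)
... | no  _   | no  _   = rank-mono-≤ es q≤r

rank-mono-< : ∀ {es e q} → e ∈ es → q ℚ.< e → rank es q ℕ.< rank es e
rank-mono-< {e ∷ es} {q = q} (here refl) q<e with e ℚ.≤? q | e ℚ.≤? e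
... | yes e≤q | _       = contradiction (ℚ.<-≤-trans q<e e≤q) (ℚ.<-irrefl refl)
... | no  _   | yes _   = s≤s (rank-mono-≤ es (ℚ.<⇒≤ q<e))
... | no  _   | no  e≰e = contradiction ℚ.≤-refl e≰e
rank-mono-< {x ∷ es} {e} {q} (there e∈es) q<e with x ℚ.≤? q | x ℚ.≤? e
... | yes _   | yes _   = s≤s (rank-mono-< e∈es q<e)
... | yes x≤q | no  x≰e = contradiction (ℚ.≤-trans x≤q (ℚ.<⇒≤ q<e)) x≰e
... | no  _   | yes _   = ℕ.m<n⇒m<1+n (rank-mono-< e∈es q<e)
... | no  _   | no  _   = rank-mono-< e∈es q<e

rank-cancel-≤ : ∀ {es e q} → e ∈ es → rank es e ℕ.≤ rank es q → e ℚ.≤ q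
rank-cancel-≤ {e = e} {q} e∈es h with e ℚ.≤? q
... | yes e≤q = e≤q
... | no  e≰q = contradiction h (ℕ.<⇒≱ (rank-mono-< e∈es (ℚ.≰⇒> e≰q)))

encode : (d k i : ℕ) → ℕ
encode d k i = i + k * suc d

encode-mono-≤ : ∀ d {k l i j} → k ℕ.≤ l → i ℕ.≤ j → encode d k i ℕ.≤ encode d l j
encode-mono-≤ d k≤l i≤j = ℕ.+-mono-≤ i≤j (ℕ.*-monoˡ-≤ (suc d) k≤l)

encode-cancel-≤ : ∀ d {k l i j} → j ℕ.≤ d → encode d k i ℕ.≤ encode d l j → k ℕ.≤ l
encode-cancel-≤ d {k} {l} {i} {j} j≤d h with k ℕ.≤? l
... | yes k≤l = k≤l
... | no  k≰l = contradiction h (ℕ.<⇒≱ (begin-strict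
  j + l * suc d   <⟨ ℕ.+-monoˡ-< (l * suc d) (s≤s j≤d) ⟩
  suc l * suc d   ≤⟨ ℕ.*-monoˡ-≤ (suc d) (ℕ.≰⇒> k≰l) ⟩
  k * suc d       ≤⟨ ℕ.m≤n+m (k * suc d) i ⟩
  i + k * suc d   ∎))
  where open ℕ.≤-Reasoning

encode-% : ∀ d k {i} → i ℕ.≤ d → encode d k i % suc d ≡ i
encode-% d k {i} i≤d = trans ([m+kn]%n≡m%n i k (suc d)) (m≤n⇒m%n≡m i≤d)

encode-injectiveʳ : ∀ d {k l i j} → i ℕ.≤ d → j ℕ.≤ d → encode d k i ≡ encode d l j → i ≡ j
encode-injectiveʳ d {k} {l} i≤d j≤d eq =
  trans (≡.sym (encode-% d k i≤d)) (trans (cong (_% suc d) eq) (encode-% d l j≤d))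

module SplitIntervalCompletion
  {n} (G G′ : Graph n) (C : VSet n) (split : IsSplitPartition G C)
  (f : Fin n → Interval) (f-model : IsIntervalModel G′ f) (G⊆G′ : G ⊆E G′) where

  open Extrema (DecTotalOrder.totalOrder ℚ.≤-decTotalOrder)
    using (argmax; f[⊥]≤f[argmax]; f[xs]≤f[argmax]; argmax-all)

  L R : Fin n → ℚ
  L u = lo (f u)
  R u = hi (f u)

  edge⇒meets : ∀ {u v} → Edge G u v → Meets (f u) (f v)
  edge⇒meets {u} {v} e = Equivalence.to (f-model u v (edge⇒≢ G e)) (G⊆G′ u v e)

  CliqueNeighbour : Fin n → Fin n → Set
  CliqueNeighbour v w = w ∈ᵥ C × Edge G v w

  cliqueNeighbour? : ∀ v w → Dec (CliqueNeighbour v w)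
  cliqueNeighbour? v w = (C w Bool.≟ true) ×-dec (adj G v w Bool.≟ true)

  cliqueNeighbours : Fin n → List (Fin n)
  cliqueNeighbours v = filter (cliqueNeighbour? v) (allFin n)

  Near : Fin n → Fin n → Set
  Near v w = w ≡ v ⊎ CliqueNeighbour v w

  near-edge : ∀ {v a b} → Near v a → Near v b → a ≢ b → Edge G a b
  near-edge (inj₁ refl)      (inj₁ refl)      a≢b = contradiction refl a≢b
  near-edge (inj₁ refl)      (inj₂ (_ , e))   _   = e
  near-edge (inj₂ (_ , e))   (inj₁ refl)      _   = edge-sym G e
  near-edge (inj₂ (ca , _))  (inj₂ (cb , _))  a≢b = proj₁ split _ _ ca cb a≢b

  near-L≤R : ∀ {v a b} → Near v a → Near v b → L a ℚ.≤ R b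
  near-L≤R {a = a} {b} na nb with a ≟ b
  ... | yes refl = ok (f a)
  ... | no  a≢b  = proj₁ (edge⇒meets (near-edge na nb a≢b))

  centre : Fin n → Fin n
  centre v = argmax L v (cliqueNeighbours v)

  stab : Fin n → ℚ
  stab v = L (centre v)

  L≤stab : ∀ {v w} → Near v w → L w ℚ.≤ stab v
  L≤stab {v} (inj₁ refl) = f[⊥]≤f[argmax] {f = L} v (cliqueNeighbours v)
  L≤stab {v} {w} (inj₂ nw) =
    lookup (f[xs]≤f[argmax] {f = L} v (cliqueNeighbours v))
      (∈-filter⁺ (cliqueNeighbour? v) (∈-allFin w) nw)

  stab≤R : ∀ {v w} → Near v w → stab v ℚ.≤ R w
  stab≤R {v} = near-L≤R near-centre
    where
    near-centre : Near v (centre v)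
    near-centre = argmax-all L {P = Near v} (inj₁ refl)
      (All.map inj₂ (all-filter (cliqueNeighbour? v) (allFin n)))

  leftRank : ℚ → ℕ
  leftRank = rank (tabulate L)

  position : ℚ → ℕ → ℕ
  position q i = encode n (leftRank q) i

  position-mono-≤ : ∀ {q r i j} → q ℚ.≤ r → i ℕ.≤ j → position q i ℕ.≤ position r j
  position-mono-≤ q≤r = encode-mono-≤ n (rank-mono-≤ (tabulate L) q≤r)

  position-cancel-≤ : ∀ w {q i j} → j ℕ.≤ n → position (L w) i ℕ.≤ position q j → L w ℚ.≤ q
  position-cancel-≤ w j≤n h = rank-cancel-≤ (∈-tabulate⁺ w) (encode-cancel-≤ n j≤n h)

  shape : Bool → Fin n → Interval
  shape true  u =
    ℕ-interval (position (L u) 0) (position (R u) n) (position-mono-≤ (ok (f u)) z≤n)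
  shape false v = ℕ-interval (position (stab v) (toℕ v)) (position (stab v) (toℕ v)) ℕ.≤-refl

  intervalH : Fin n → Interval
  intervalH u = shape (C u) u

  H : Graph n
  H = intersectionGraph intervalH

  H-model : IsIntervalModel H intervalH
  H-model = intersectionGraph-model intervalH

  cliques-meet : ∀ {u v} → Meets (f u) (f v) → Meets (shape true u) (shape true v)
  cliques-meet (p , q) = fromℕ-mono-≤ (position-mono-≤ p z≤n) , fromℕ-mono-≤ (position-mono-≤ q z≤n)

  cliques-meet⁻ : ∀ {u v} → Meets (shape true u) (shape true v) → Meets (f u) (f v)
  cliques-meet⁻ {u} {v} (p , q) =
    position-cancel-≤ u ℕ.≤-refl (fromℕ-cancel-≤ p) , position-cancel-≤ v ℕ.≤-refl (fromℕ-cancel-≤ q)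

  clique-point-meet : ∀ {c v} → CliqueNeighbour v c → Meets (shape true c) (shape false v)
  clique-point-meet {c} {v} nc =
      fromℕ-mono-≤ (position-mono-≤ (L≤stab (inj₂ nc)) z≤n)
    , fromℕ-mono-≤ (position-mono-≤ (stab≤R (inj₂ nc)) (toℕ≤n v))

  clique-point-meet⁻ : ∀ {c v} → Meets (shape true c) (shape false v) → Meets (f c) (f v)
  clique-point-meet⁻ {c} {v} (p , q) =
      ℚ.≤-trans (position-cancel-≤ c (toℕ≤n v) (fromℕ-cancel-≤ p)) (stab≤R (inj₁ refl))
    , ℚ.≤-trans (L≤stab (inj₁ refl)) (position-cancel-≤ (centre v) ℕ.≤-refl (fromℕ-cancel-≤ q))

  points-meet⇒≡ : ∀ {u v} → Meets (shape false u) (shape false v) → u ≡ v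
  points-meet⇒≡ {u} {v} (p , q) = toℕ-injective
    (encode-injectiveʳ n {leftRank (stab u)} {leftRank (stab v)} (toℕ≤n u) (toℕ≤n v)
      (ℕ.≤-antisym (fromℕ-cancel-≤ p) (fromℕ-cancel-≤ q)))

  edge⇒intervalsH-meet : ∀ {u v} → Edge G u v → Meets (intervalH u) (intervalH v)
  edge⇒intervalsH-meet {u} {v} e with C u in cu | C v in cv
  ... | true  | true  = cliques-meet (edge⇒meets e)
  ... | true  | false = clique-point-meet (cu , edge-sym G e)
  ... | false | true  = meets-sym {shape true v} {shape false u} (clique-point-meet (cv , e))
  ... | false | false = contradiction e (proj₂ split u v (cong not cu) (cong not cv))

  intervalsH-meet⇒meets : ∀ {u v} → u ≢ v → Meets (intervalH u) (intervalH v) → Meets (f u) (f v)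
  intervalsH-meet⇒meets {u} {v} u≢v with C u | C v
  ... | true  | true  = cliques-meet⁻
  ... | true  | false = clique-point-meet⁻
  ... | false | true  =
    meets-sym {f v} {f u} ∘ clique-point-meet⁻ ∘ meets-sym {shape false u} {shape true v}
  ... | false | false = λ m → contradiction (points-meet⇒≡ m) u≢v

  G⊆H : G ⊆E H
  G⊆H u v e = Equivalence.from (H-model u v (edge⇒≢ G e)) (edge⇒intervalsH-meet e)

  H⊆G′ : H ⊆E G′
  H⊆G′ u v e = Equivalence.from (f-model u v u≢v)
    (intervalsH-meet⇒meets u≢v (Equivalence.to (H-model u v u≢v) e))
    where u≢v = edge⇒≢ H e

  H-clique : IsClique H C
  H-clique u v cu cv u≢v = G⊆H u v (proj₁ split u v cu cv u≢v)

  H-independent : IsIndependent H (Complement C)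
  H-independent u v iu iv e = u≢v (points-meet⇒≡ (subst₂ (λ a b → Meets (shape a u) (shape b v))
    (Bool.not-injective iu) (Bool.not-injective iv) (Equivalence.to (H-model u v u≢v) e)))
    where u≢v = edge⇒≢ H e

lemma4 : ∀ {n : ℕ} (G G′ : Graph n) (C : VSet n) →
    IsSplitPartition G C →
    IsInterval G′ →
    G ⊆E G′ →
    ∃[ H ] (IsSplitInterval H × G ⊆E H × H ⊆E G′ × IsIndependent H (Complement C))
lemma4 G G′ C split (f , f-model) G⊆G′ =
  H , ((C , H-clique , H-independent) , intervalH , H-model) , G⊆H , H⊆G′ , H-independent
  where open SplitIntervalCompletion G G′ C split f f-model G⊆G′
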